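{- For all non-negative real numbers $x,y,z$, $x+y=z$ if and only if \[ ((z+1)x+1)((z+1)(y+1)+1)=(z+1)^2(x(y+1)+1)+1 . \] -}

module Defs where

open import Level using (Level; suc; _⊔_)
open import Algebra.Bundles using (CommutativeRing)
open import Relation.Binary.Structures using (IsTotalOrder)
open import Relation.Nullary using (¬_)
open import Data.Product using (Σ)

-- An ordered field, axiomatised in the standard way (the real numbers are
-- the intended instance; the statement is quantified over all of them).
record OrderedField (c ℓ ℓ′ : Level) : Set (suc (c ⊔ ℓ ⊔ ℓ′)) where
  field
    commutativeRing : CommutativeRing c ℓ
  open CommutativeRing commutativeRing public
  field
    _≤_          : Carrier → Carrier → Set ℓ′
    isTotalOrder : IsTotalOrder _≈_ _≤_
    +-mono-≤     : ∀ {x y} z → x ≤ y → (x + z) ≤ (y + z)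
    *-nonneg     : ∀ {x y} → 0# ≤ x → 0# ≤ y → 0# ≤ (x * y)
    0≉1          : ¬ (0# ≈ 1#)
    inverse      : ∀ x → ¬ (x ≈ 0#) → Σ Carrier (λ y → (x * y) ≈ 1#)

-- Expanding, the left side minus the right side is (z + 1)(x + y + 1) − (z + 1)²
-- in any commutative ring. Since z ≥ 0 makes z + 1 invertible, this vanishes
-- exactly when x + y + 1 = z + 1.
module Submission where

open import Defs
open import Algebra.Bundles using (AbelianGroup; CommutativeSemiring)
open import Data.Product using (_×_; _,_)
open import Data.Sum using (inj₁; inj₂)
open import Function.Bundles using (_⇔_; mk⇔; module Equivalence)
open import Function.Properties.Equivalence using (⇔-setoid)
open import Relation.Binary.Structures using (IsTotalOrder)
open import Relation.Nullary using (¬_)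
import Algebra.Properties.AbelianGroup as AbelianGroupProperties
import Algebra.Properties.Ring as RingProperties
import Algebra.Solver.Ring.NaturalCoefficients.Default as Solver
import Relation.Binary.Reasoning.Setoid as SetoidReasoning

module _ {c ℓ} (S : CommutativeSemiring c ℓ) where
  open CommutativeSemiring S
  open Solver S

  expansion : ∀ w x y →
    (w * x + 1#) * (w * (y + 1#) + 1#) + w * w
      ≈ ((w * w) * (x * (y + 1#) + 1#) + 1#) + w * (x + y + 1#)
  expansion = solve 3 (λ w x y →
    (w :* x :+ con 1) :* (w :* (y :+ con 1) :+ con 1) :+ w :* w
      := ((w :* w) :* (x :* (y :+ con 1) :+ con 1) :+ con 1) :+ w :* (x :+ y :+ con 1))
    refl

module _ {a ℓ} (G : AbelianGroup a ℓ) where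
  open AbelianGroup G
  open AbelianGroupProperties G using (∙-cancelˡ; ∙-cancelʳ)

  ∙-balance⇔ : ∀ {a b p q} → a ∙ p ≈ b ∙ q → (a ≈ b ⇔ p ≈ q)
  ∙-balance⇔ {a} {b} {p} {q} ap≈bq = mk⇔
    (λ a≈b → ∙-cancelˡ b p q (trans (∙-congʳ (sym a≈b)) ap≈bq))
    (λ p≈q → ∙-cancelʳ q a b (trans (∙-congˡ (sym p≈q)) ap≈bq))

  ∙-cancelʳ⇔ : ∀ c {a b} → (a ∙ c ≈ b ∙ c ⇔ a ≈ b)
  ∙-cancelʳ⇔ c = mk⇔ (∙-cancelʳ c _ _) ∙-congʳ

module _ {c ℓ ℓ′} (F : OrderedField c ℓ ℓ′) where
  open OrderedField F
  open IsTotalOrder isTotalOrder using (total; antisym; ≤-respˡ-≈; ≤-respʳ-≈)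
  open AbelianGroupProperties +-abelianGroup using (⁻¹-involutive)
  open RingProperties ring using (-1*x≈-x)
  open SetoidReasoning setoid

  0≤1 : 0# ≤ 1#
  0≤1 with total 0# 1#
  ... | inj₁ 0≤1′ = 0≤1′
  ... | inj₂ 1≤0 = ≤-respʳ-≈ -1*-1≈1 (*-nonneg 0≤-1 0≤-1)
    where
    0≤-1 : 0# ≤ (- 1#)
    0≤-1 = ≤-respˡ-≈ (-‿inverseʳ 1#) (≤-respʳ-≈ (+-identityˡ (- 1#)) (+-mono-≤ (- 1#) 1≤0))
    -1*-1≈1 : - 1# * - 1# ≈ 1#
    -1*-1≈1 = trans (-1*x≈-x (- 1#)) (⁻¹-involutive 1#)

  nonneg⇒+1≉0 : ∀ {z} → 0# ≤ z → ¬ (z + 1# ≈ 0#)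
  nonneg⇒+1≉0 {z} 0≤z z+1≈0 = 0≉1 (antisym 0≤1 1≤0)
    where
    1≤0 : 1# ≤ 0#
    1≤0 = ≤-respˡ-≈ (+-identityˡ 1#) (≤-respʳ-≈ z+1≈0 (+-mono-≤ 1# 0≤z))

  *-cancelˡ-≉0 : ∀ {w a b} → ¬ (w ≈ 0#) → w * a ≈ w * b → a ≈ b
  *-cancelˡ-≉0 {w} {a} {b} w≉0 wa≈wb with inverse w w≉0
  ... | v , wv≈1 = begin
    a           ≈⟨ v[wa]≈a a ⟨
    v * (w * a) ≈⟨ *-congˡ wa≈wb ⟩
    v * (w * b) ≈⟨ v[wa]≈a b ⟩
    b           ∎
    where
    v[wa]≈a : ∀ a → v * (w * a) ≈ a
    v[wa]≈a a = begin
      v * (w * a) ≈⟨ *-assoc v w a ⟨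
      (v * w) * a ≈⟨ *-congʳ (trans (*-comm v w) wv≈1) ⟩
      1# * a      ≈⟨ *-identityˡ a ⟩
      a           ∎

  *-cancelˡ⇔ : ∀ {w a b} → ¬ (w ≈ 0#) → (w * a ≈ w * b ⇔ a ≈ b)
  *-cancelˡ⇔ w≉0 = mk⇔ (*-cancelˡ-≉0 w≉0) *-congˡ

lemma12 : ∀ {c ℓ ℓ′} (F : OrderedField c ℓ ℓ′) → let open OrderedField F in
    ∀ x y z → 0# ≤ x → 0# ≤ y → 0# ≤ z →
      (((x + y) ≈ z) → (((z + 1#) * x + 1#) * ((z + 1#) * (y + 1#) + 1#) ≈ (((z + 1#) * (z + 1#)) * (x * (y + 1#) + 1#) + 1#)))
      × ((((z + 1#) * x + 1#) * ((z + 1#) * (y + 1#) + 1#) ≈ (((z + 1#) * (z + 1#)) * (x * (y + 1#) + 1#) + 1#)) → ((x + y) ≈ z))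
lemma12 F x y z _ _ 0≤z = Equivalence.from sides≈⇔x+y≈z , Equivalence.to sides≈⇔x+y≈z
  where
  open OrderedField F
  open SetoidReasoning (⇔-setoid _)
  w : Carrier
  w = z + 1#
  sides≈⇔x+y≈z : ((w * x + 1#) * (w * (y + 1#) + 1#) ≈ (w * w) * (x * (y + 1#) + 1#) + 1#) ⇔ (x + y ≈ z)
  sides≈⇔x+y≈z = begin
    (w * x + 1#) * (w * (y + 1#) + 1#) ≈ (w * w) * (x * (y + 1#) + 1#) + 1#
      ≈⟨ ∙-balance⇔ +-abelianGroup (expansion commutativeSemiring w x y) ⟩
    w * w ≈ w * (x + y + 1#)  ≈⟨ *-cancelˡ⇔ F (nonneg⇒+1≉0 F 0≤z) ⟩
    w ≈ x + y + 1#            ≈⟨ mk⇔ sym sym ⟩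
    x + y + 1# ≈ z + 1#       ≈⟨ ∙-cancelʳ⇔ +-abelianGroup 1# ⟩
    x + y ≈ z                 ∎
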